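{- Equip each straight snake graph $\mathcal{G}^s_N$ with its standard labeling. Then: (a) For every $n\ge2$, $|\Omega(\mathcal{G}^s_{n-2})| = E_n$. (b) For every $n\ge3$ and $1\le k\le n$, the number of mixed dimer covers of $\mathcal{G}^s_{n-2}$ (standard labeling) in which the right-most vertical edge has multiplicity $n-k$ equals the Entringer number $E_{n,n+1-k}$. Moreover, for $n\ge 4$, this number also equals the number of mixed dimer covers of $\mathcal{G}^s_{n-3}$ with vertex labeling $\mathbf{n}_x$, $x=(1,2,\dots,n-3,\,n-1-k)$ (interpreted as $0$ when $n-1-k<0$).
   Context: Mixed dimer covers: for a finite graph $\mathcal{G}=(V,E)$ and $\mathbf{n}\colon V\to\mathbb{N}$, a mixed dimer cover is a function $\omega\colon E\to\mathbb{N}$ (edge multiplicities) with $\sum_{e\ni v}\omega(e)=\mathbf{n}(v)$ for each vertex $v$. $\mathcal{G}^s_N$ is the $2\times(N+1)$ grid graph with bottom vertices $v_{1,0},\dots,v_{1,N}$ and top vertices $v_{2,0},\dots,v_{2,N}$, vertical edges $v_{1,k}v_{2,k}$ and horizontal edges $v_{r,k-1}v_{r,k}$. For $x=(x_0,\dots,x_N)$, the labeling $\mathbf{n}_x$ gives both $v_{1,k},v_{2,k}$ the value $x_k$. The standard labeling of $\mathcal{G}^s_N$ is $\mathbf{n}_x$ with $x=(1,2,\dots,N+1)$, and $\Omega(\mathcal{G}^s_N)$ denotes the set of mixed dimer covers for the standard labeling. A permutation $\sigma\in S_n$ is alternating if $\sigma(1)>\sigma(2)<\sigma(3)>\sigma(4)<\cdots$.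 The Euler number $E_n$ is the number of alternating permutations in $S_n$, and the Entringer number $E_{n,k}$ is the number of alternating $\sigma\in S_n$ with $\sigma(1)=k$. -}

module Defs where

open import Data.Nat using (ℕ; zero; suc; _+_; _∸_; _<_; _≤_)
open import Data.Nat.ListAction using (sum)
open import Data.Fin as Fin using (Fin; toℕ; inject₁)
open import Data.Fin.Properties as FinP using ()
open import Data.Product using (_×_; _,_; proj₁; proj₂; Σ; ∃)
open import Data.Product.Properties using (≡-dec)
open import Data.List as List using (List; []; _∷_; _++_; length; zipWith; upTo; allFin)
open import Data.List.Relation.Unary.Unique.Propositional using (Unique)
open import Data.List.Membership.Propositional using (_∈_)
open import Data.List.Relation.Binary.Permutation.Propositional using (_↭_)
open import Data.Vec as Vec using (Vec; toList; tabulate; _∷ʳ_)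
open import Data.Bool using (Bool; true; false; if_then_else_; _∨_)
open import Data.Maybe using (Maybe; just)
open import Data.Unit using (⊤)
open import Relation.Binary.PropositionalEquality using (_≡_)
open import Relation.Binary.Definitions using (DecidableEquality)
open import Relation.Nullary.Decidable using (⌊_⌋)
open import Function.Bundles using (_⇔_)

HasCount : {A : Set} → (A → Set) → ℕ → Set
HasCount {A} P m =
  Σ (List A) λ L → Unique L × ((a : A) → (a ∈ L) ⇔ P a) × length L ≡ m

record Graph : Set₁ where
  field
    V     : Set
    _≟V_  : DecidableEquality V
    edges : List (V × V)

  -- an edge-multiplicity function ω : E → ℕ, one entry per listed edge
  EdgeFun : Set
  EdgeFun = Vec ℕ (length edges)

  incident : V → V × V → Bool
  incident v (a , b) = ⌊ v ≟V a ⌋ ∨ ⌊ v ≟V b ⌋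

  degree : EdgeFun → V → ℕ
  degree ω v = sum (zipWith (λ e m → if incident v e then m else 0) edges (toList ω))

  multAt : EdgeFun → V × V → ℕ
  multAt ω e = sum (zipWith (λ e' m → if ⌊ ≡-dec _≟V_ _≟V_ e e' ⌋ then m else 0) edges (toList ω))

  IsMixedDimerCover : (V → ℕ) → EdgeFun → Set
  IsMixedDimerCover n ω = (v : V) → degree ω v ≡ n v

open Graph public

-- Straight snake graph G^s_N : 2 × (N+1) grid.
-- Vertex (r , k) with r : Fin 2 (0 = bottom row, 1 = top row) and
-- k : Fin (N+1) stands for v_{r+1,k}.

SnakeV : ℕ → Set
SnakeV N = Fin 2 × Fin (suc N)

v₁ v₂ : {N : ℕ} → Fin (suc N) → SnakeV N
v₁ k = (Fin.zero , k)
v₂ k = (Fin.suc Fin.zero , k)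

snakeEdges : (N : ℕ) → List (SnakeV N × SnakeV N)
snakeEdges N =
     List.map (λ k → (v₁ k , v₂ k)) (allFin (suc N))
  ++ List.map (λ k → (v₁ (inject₁ k) , v₁ (Fin.suc k))) (allFin N)
  ++ List.map (λ k → (v₂ (inject₁ k) , v₂ (Fin.suc k))) (allFin N)

Snake : ℕ → Graph
Snake N = record
  { V = SnakeV N
  ; _≟V_ = ≡-dec FinP._≟_ FinP._≟_
  ; edges = snakeEdges N }

labelOf : {N : ℕ} → Vec ℕ (suc N) → SnakeV N → ℕ
labelOf x (_ , k) = Vec.lookup x k

standardX : (N : ℕ) → Vec ℕ (suc N)
standardX N = tabulate (λ k → suc (toℕ k))

modifiedX : (N : ℕ) → ℕ → Vec ℕ (suc N)
modifiedX N c = tabulate {N} (λ k → suc (toℕ k)) ∷ʳ c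

CoverOf : (N : ℕ) → Vec ℕ (suc N) → EdgeFun (Snake N) → Set
CoverOf N x = IsMixedDimerCover (Snake N) (labelOf x)

Ω : (N : ℕ) → EdgeFun (Snake N) → Set
Ω N = CoverOf N (standardX N)

rightVertical : (N : ℕ) → SnakeV N × SnakeV N
rightVertical N = (v₁ (Fin.fromℕ N) , v₂ (Fin.fromℕ N))

-- Permutations of {1,…,n}, as the word σ(1) σ(2) … σ(n)

IsPerm : (n : ℕ) → Vec ℕ n → Set
IsPerm n σ = toList σ ↭ List.map suc (upTo n)

mutual
  DownAlt : List ℕ → Set
  DownAlt [] = ⊤
  DownAlt (x ∷ []) = ⊤
  DownAlt (x ∷ y ∷ r) = y < x × UpAlt (y ∷ r)

  UpAlt : List ℕ → Set
  UpAlt [] = ⊤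
  UpAlt (x ∷ []) = ⊤
  UpAlt (x ∷ y ∷ r) = x < y × DownAlt (y ∷ r)

AlternatingPerm : (n : ℕ) → Vec ℕ n → Set
AlternatingPerm n σ = IsPerm n σ × DownAlt (toList σ)

EntringerPerm : (n k : ℕ) → Vec ℕ n → Set
EntringerPerm n k σ = AlternatingPerm n σ × List.head (toList σ) ≡ just k

{-# OPTIONS --safe #-}

-- Both sides are counted by the Entringer recurrence E(n+1, k) = Σ_{1≤j<k} E(n, n+1−j).
--
-- Deleting σ(1) = k from a down-up permutation with σ(2) = j, complementing the remaining values
-- and closing the gap at k leaves a down-up permutation of one size less starting with n+1−j.
--
-- In a mixed dimer cover of the 2 × (N+1) snake labelled x, comparing the two degree conditions
-- column by column shows that both rows carry the same horizontal multiplicities h₀, …, h_{N−1};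
-- the vertical edge of column t then has multiplicity x_t − h_t − h_{t−1} (with h_{−1} = h_N = 0).
-- So covers are the sequences with h_t + h_{t−1} ≤ x_t, and the right-most vertical edge has
-- multiplicity x_N − h_{N−1}. For x_t = t + 1, sorting the sequences of length m with last entry
-- t by their previous entry j, which ranges over j + t ≤ m + 1, gives the Entringer recurrence:
-- there are E(m+2, m+2−t) of them. Summing over t ≤ x_N, the labelling (1, …, N, c) has
-- E(N+3, c+2) covers; for c = N+1 this is the Euler number E(N+3, N+3) = E_{N+2}.

module Submission where

open import Defs
open import Data.Nat
  using (ℕ; zero; suc; pred; _+_; _∸_; _≤_; _<_; z≤n; s≤s; s≤s⁻¹; _<?_; _≟_; _≡ᵇ_; _<ᵇ_)
open import Data.Nat.Properties
  using (≤-refl; ≤-trans; <-trans; <⇒≤; n≤1+n; n<1+n; <-irrefl; ≤-antisym; ≤∧≢⇒<; ≮⇒≥; n≤0⇒n≡0;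
         n≮0; m<n⇒m<1+n; pred-mono-≤; m∸n≤m; m<n⇒0<n∸m; ∸-monoʳ-<; m∸[m∸n]≡n; suc-injective; m<m+n;
         +-suc; +-identityʳ; +-assoc; +-comm; +-cancelˡ-≡; +-cancelʳ-≡; m∸n+n≡m; m+n∸n≡m; m≤n+m;
         0∸n≡0; pred[m∸n]≡m∸[1+n]; ∸-cancelˡ-≡; +-∸-assoc)
open import Data.Nat.ListAction using (sum)
open import Data.Bool using (Bool; false; if_then_else_; _∨_; _∧_)
open import Data.Bool.Properties using (∨-identityʳ; ∧-idem; ∧-zeroʳ)
open import Data.Fin as Fin using (Fin; toℕ; inject₁; fromℕ; fromℕ<)
open import Data.Fin.Properties using (toℕ-inject₁; toℕ-fromℕ; toℕ<n; toℕ-fromℕ<)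
open import Data.List
  using (List; []; _∷_; _++_; _∷ʳ_; length; map; zipWith; allFin; tabulate; applyUpTo; upTo;
         initLast; _∷ʳ′_)
open import Data.List.Properties
  using (length-++; length-map; length-tabulate; map-tabulate; length-applyUpTo; ∷-injective; ∷-injectiveʳ;
         ∷ʳ-injectiveˡ)
open import Data.List.Relation.Unary.All as All using (All; []; _∷_)
open import Data.List.Relation.Unary.All.Properties as Allₚ using ()
open import Data.List.Relation.Unary.AllPairs using ([]; _∷_)
open import Data.List.Relation.Unary.Any using (here; there)
open import Data.List.Relation.Unary.Unique.Propositional using (Unique)
open import Data.List.Relation.Unary.Unique.Propositional.Properties as Uniqueₚ using ()
open import Data.List.Relation.Binary.Permutation.Propositional using (_↭_; ↭-refl; ↭-sym; ↭⇒↭ₛ)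
open import Data.List.Relation.Binary.Permutation.Propositional.Properties using (∈-resp-↭)
open import Data.List.Relation.Binary.Permutation.Setoid.Properties as Permₛ using ()
open import Data.List.Relation.Binary.BagAndSetEquality using (∼bag⇒↭)
open import Data.List.Membership.Propositional using (_∈_)
open import Data.List.Membership.Propositional.Properties
  using (∈-++⁺ˡ; ∈-++⁺ʳ; ∈-++⁻; ∈-map⁺; ∈-map⁻; ∈-upTo⁺; ∈-upTo⁻)
open import Data.List.Membership.Propositional.Properties.WithK using (unique∧set⇒bag)
open import Data.Vec as Vec using (Vec; _∷_; toList; lookup)
open import Data.Vec.Properties using (toList-map; toList-injective; cast-is-id; length-toList; lookup∘tabulate)
open import Data.Maybe using (just)
open import Data.Maybe.Properties using (just-injective)
open import Data.Product using (Σ; ∃; _×_; _,_; proj₁; proj₂)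
open import Data.Product.Properties using (≡-dec)
open import Data.Sum using (_⊎_; inj₁; inj₂; [_,_])
open import Data.Unit using (⊤; tt)
open import Data.Empty using (⊥-elim)
open import Function using (_∘_)
open import Function.Bundles using (_⇔_; mk⇔; Equivalence)
open import Relation.Binary.Definitions using (DecidableEquality)
open import Relation.Nullary using (¬_; yes; no)
open import Relation.Nullary.Decidable using (⌊_⌋)
open import Relation.Binary.PropositionalEquality
  using (_≡_; _≢_; refl; sym; trans; cong; cong₂; subst; subst₂; setoid; module ≡-Reasoning)

private
  variable
    A B : Set
    P Q : A → Set
    m n : ℕ

open Equivalence using (to; from)

HasCount-cong : (∀ a → P a → Q a) → (∀ a → Q a → P a) → HasCount P m → HasCount Q m
HasCount-cong P⇒Q Q⇒P (L , unique , mem , len) =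
  L , unique , (λ a → mk⇔ (P⇒Q a ∘ to (mem a)) (from (mem a) ∘ Q⇒P a)) , len

HasCount-empty : (∀ a → ¬ P a) → HasCount P 0
HasCount-empty ¬P = [] , [] , (λ a → mk⇔ (λ ()) (⊥-elim ∘ ¬P a)) , refl

HasCount-singleton : (a₀ : A) → HasCount (_≡ a₀) 1
HasCount-singleton a₀ =
  a₀ ∷ [] , [] ∷ [] , (λ a → mk⇔ (λ { (here a≡a₀) → a≡a₀ ; (there ()) }) here) , refl

HasCount-⊎ : HasCount P m → HasCount Q n → (∀ a → P a → ¬ Q a) →
             HasCount (λ a → P a ⊎ Q a) (m + n)
HasCount-⊎ (L , uL , memL , lenL) (K , uK , memK , lenK) disjoint =
  L ++ K ,
  Uniqueₚ.++⁺ uL uK (λ (a∈L , a∈K) → disjoint _ (to (memL _) a∈L) (to (memK _) a∈K)) ,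
  (λ a → mk⇔ ([ inj₁ ∘ to (memL a) , inj₂ ∘ to (memK a) ] ∘ ∈-++⁻ L)
              [ ∈-++⁺ˡ ∘ from (memL a) , ∈-++⁺ʳ L ∘ from (memK a) ]) ,
  trans (length-++ L) (cong₂ _+_ lenL lenK)

Unique-map-injectiveOn : (f : A → B) {L : List A} →
  (∀ {x y} → x ∈ L → y ∈ L → f x ≡ f y → x ≡ y) → Unique L → Unique (map f L)
Unique-map-injectiveOn f inj [] = []
Unique-map-injectiveOn f inj (x∉L ∷ uL) =
  Allₚ.map⁺ (All.tabulate λ y∈L fx≡fy → All.lookup x∉L y∈L (inj (here refl) (there y∈L) fx≡fy))
  ∷ Unique-map-injectiveOn f (λ x∈ y∈ → inj (there x∈) (there y∈)) uL

HasCount-bijection : (f : A → B) →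
  (∀ a → P a → Q (f a)) →
  (∀ a a′ → P a → P a′ → f a ≡ f a′ → a ≡ a′) →
  (∀ b → Q b → Σ A λ a → P a × f a ≡ b) →
  HasCount P m → HasCount Q m
HasCount-bijection {Q = Q} f P⇒Q inj surj (L , uL , mem , len) =
  map f L ,
  Unique-map-injectiveOn f (λ x∈ y∈ → inj _ _ (to (mem _) x∈) (to (mem _) y∈)) uL ,
  (λ b → mk⇔ (λ b∈ → let a , a∈ , fa≡b = ∈-map⁻ f b∈ in
                      subst Q (sym fa≡b) (P⇒Q a (to (mem a) a∈)))
             (λ Qb → let a , Pa , fa≡b = surj b Qb in
                      subst (_∈ map f L) fa≡b (∈-map⁺ f (from (mem a) Pa)))) ,
  trans (length-map f L) len

sumRange : (ℕ → ℕ) → ℕ → ℕ → ℕ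
sumRange f lo zero      = 0
sumRange f lo (suc len) = f lo + sumRange f (suc lo) len

HasCount-partition : (key : A → ℕ) (c : ℕ → ℕ) (lo len : ℕ) →
  (∀ a → P a → lo ≤ key a × key a < lo + len) →
  (∀ j → lo ≤ j → j < lo + len → HasCount (λ a → P a × key a ≡ j) (c j)) →
  HasCount P (sumRange c lo len)
HasCount-partition key c lo zero range parts =
  HasCount-empty λ a Pa → let lo≤k , k<lo+0 = range a Pa in
    <-irrefl refl (≤-trans (s≤s lo≤k) (subst (_ ≤_) (+-identityʳ lo) k<lo+0))
HasCount-partition {P = P} key c lo (suc len) range parts =
  HasCount-cong join split
    (HasCount-⊎ (parts lo ≤-refl (m<m+n lo (s≤s z≤n)))
                (HasCount-partition key c (suc lo) len range′ parts′)
                (λ a (_ , k≡lo) (_ , k≢lo) → k≢lo k≡lo))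
  where
  range′ : ∀ a → P a × key a ≢ lo → suc lo ≤ key a × key a < suc lo + len
  range′ a (Pa , k≢lo) = let lo≤k , k< = range a Pa in
    ≤∧≢⇒< lo≤k (k≢lo ∘ sym) , subst (key a <_) (+-suc lo len) k<
  parts′ : ∀ j → suc lo ≤ j → j < suc lo + len →
           HasCount (λ a → (P a × key a ≢ lo) × key a ≡ j) (c j)
  parts′ j lo<j j< =
    HasCount-cong (λ a (Pa , k≡j) → (Pa , λ k≡lo → <-irrefl (trans (sym k≡lo) k≡j) lo<j) , k≡j)
                  (λ a ((Pa , _) , k≡j) → Pa , k≡j)
                  (parts j (≤-trans (n≤1+n lo) lo<j) (subst (j <_) (sym (+-suc lo len)) j<))
  join : ∀ a → (P a × key a ≡ lo) ⊎ (P a × key a ≢ lo) → P a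
  join a (inj₁ (Pa , _)) = Pa
  join a (inj₂ (Pa , _)) = Pa
  split : ∀ a → P a → (P a × key a ≡ lo) ⊎ (P a × key a ≢ lo)
  split a Pa with key a ≟ lo
  ... | yes k≡lo = inj₁ (Pa , k≡lo)
  ... | no k≢lo  = inj₂ (Pa , k≢lo)

-- Alternating permutations and Entringer numbers

InRange : ℕ → ℕ → Set
InRange n v = 1 ≤ v × v ≤ n

Enumerates : ℕ → List ℕ → Set
Enumerates n l = Unique l × (∀ v → v ∈ l ⇔ InRange n v)

∈-range⇔InRange : ∀ n v → v ∈ map suc (upTo n) ⇔ InRange n v
∈-range⇔InRange n v = mk⇔ to′ from′
  where
  to′ : v ∈ map suc (upTo n) → InRange n v
  to′ v∈ with ∈-map⁻ suc v∈
  ... | u , u∈ , refl = s≤s z≤n , ∈-upTo⁻ u∈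
  from′ : ∀ {v} → InRange n v → v ∈ map suc (upTo n)
  from′ {suc u} (_ , v≤n) = ∈-map⁺ suc (∈-upTo⁺ v≤n)

Unique-range : ∀ n → Unique (map suc (upTo n))
Unique-range n = Uniqueₚ.map⁺ suc-injective (Uniqueₚ.upTo⁺ n)

↭-range⇒Enumerates : ∀ {n l} → l ↭ map suc (upTo n) → Enumerates n l
↭-range⇒Enumerates {n} l↭ =
  Permₛ.Unique-resp-↭ (setoid ℕ) (↭⇒↭ₛ (↭-sym l↭)) (Unique-range n) ,
  λ v → mk⇔ (to (∈-range⇔InRange n v) ∘ ∈-resp-↭ l↭)
            (∈-resp-↭ (↭-sym l↭) ∘ from (∈-range⇔InRange n v))

Enumerates⇒↭-range : ∀ {n l} → Enumerates n l → l ↭ map suc (upTo n)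
Enumerates⇒↭-range {n} (unique , mem) =
  ∼bag⇒↭ (unique∧set⇒bag unique (Unique-range n)
    λ {v} → mk⇔ (from (∈-range⇔InRange n v) ∘ to (mem v)) (from (mem v) ∘ to (∈-range⇔InRange n v)))

module _ {R : ℕ → Set} (f : ℕ → ℕ) (f-antitone : ∀ {a b} → R a → R b → a < b → f b < f a) where
  mutual
    DownAlt⇒UpAlt-map : ∀ {l} → All R l → DownAlt l → UpAlt (map f l)
    DownAlt⇒UpAlt-map {[]}        _              _          = tt
    DownAlt⇒UpAlt-map {_ ∷ []}    _              _          = tt
    DownAlt⇒UpAlt-map {x ∷ y ∷ l} (Rx ∷ Ry ∷ Rl) (y<x , up) =
      f-antitone Ry Rx y<x , UpAlt⇒DownAlt-map (Ry ∷ Rl) up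

    UpAlt⇒DownAlt-map : ∀ {l} → All R l → UpAlt l → DownAlt (map f l)
    UpAlt⇒DownAlt-map {[]}        _              _          = tt
    UpAlt⇒DownAlt-map {_ ∷ []}    _              _          = tt
    UpAlt⇒DownAlt-map {x ∷ y ∷ l} (Rx ∷ Ry ∷ Rl) (x<y , dn) =
      f-antitone Rx Ry x<y , DownAlt⇒UpAlt-map (Ry ∷ Rl) dn

map-inverseOn : ∀ {R : A → Set} (f : A → B) (g : B → A) {l} → All R l → (∀ {x} → R x → g (f x) ≡ x) →
                map g (map f l) ≡ l
map-inverseOn f g []         inv = refl
map-inverseOn f g (Rx ∷ Rl) inv = cong₂ _∷_ (inv Rx) (map-inverseOn f g Rl inv)

toList-injective-≡ : ∀ (xs ys : Vec A n) → toList xs ≡ toList ys → xs ≡ ys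
toList-injective-≡ xs ys eq = trans (sym (cast-is-id refl xs)) (toList-injective refl xs ys eq)

punchIn : ℕ → ℕ → ℕ
punchIn k v with v <? k
... | yes _ = v
... | no  _ = suc v

punchOut : ℕ → ℕ → ℕ
punchOut k w with w <? k
... | yes _ = w
... | no  _ = pred w

punchIn-< : ∀ {k v} → v < k → punchIn k v ≡ v
punchIn-< {k} {v} v<k with v <? k
... | yes _   = refl
... | no  v≮k = ⊥-elim (v≮k v<k)

punchIn-≮ : ∀ {k v} → ¬ v < k → punchIn k v ≡ suc v
punchIn-≮ {k} {v} v≮k with v <? k
... | yes v<k = ⊥-elim (v≮k v<k)
... | no  _   = refl

punchOut-< : ∀ {k w} → w < k → punchOut k w ≡ w
punchOut-< {k} {w} w<k with w <? k
... | yes _   = refl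
... | no  w≮k = ⊥-elim (w≮k w<k)

punchOut-≮ : ∀ {k w} → ¬ w < k → punchOut k w ≡ pred w
punchOut-≮ {k} {w} w≮k with w <? k
... | yes w<k = ⊥-elim (w≮k w<k)
... | no  _   = refl

private
  ≮∧≢⇒> : ∀ {k w} → ¬ w < k → w ≢ k → k < w
  ≮∧≢⇒> w≮k w≢k = ≤∧≢⇒< (≮⇒≥ w≮k) (w≢k ∘ sym)

punchIn-mono-< : ∀ k {a b} → a < b → punchIn k a < punchIn k b
punchIn-mono-< k {a} {b} a<b with a <? k | b <? k
... | yes _   | yes _   = a<b
... | yes _   | no  _   = m<n⇒m<1+n a<b
... | no  a≮k | yes b<k = ⊥-elim (a≮k (<-trans a<b b<k))
... | no  _   | no  _   = s≤s a<b

punchIn≢ : ∀ k v → punchIn k v ≢ k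
punchIn≢ k v with v <? k
... | yes v<k = λ v≡k → <-irrefl v≡k v<k
... | no  v≮k = λ 1+v≡k → v≮k (subst (v <_) 1+v≡k ≤-refl)

punchIn-bounds : ∀ k v → v ≤ punchIn k v × punchIn k v ≤ suc v
punchIn-bounds k v with v <? k
... | yes _ = ≤-refl , n≤1+n v
... | no  _ = n≤1+n v , ≤-refl

punchOut-punchIn : ∀ k v → punchOut k (punchIn k v) ≡ v
punchOut-punchIn k v with v <? k
... | yes v<k = punchOut-< v<k
... | no  v≮k = punchOut-≮ {k} {suc v} (λ 1+v<k → v≮k (<-trans (n<1+n v) 1+v<k))

punchIn-punchOut : ∀ {k w} → w ≢ k → punchIn k (punchOut k w) ≡ w
punchIn-punchOut {k} {w} w≢k with w <? k
... | yes w<k = punchIn-< w<k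
punchIn-punchOut {k} {zero}  w≢k | no w≮k = ⊥-elim (w≢k (sym (n≤0⇒n≡0 (≮⇒≥ w≮k))))
punchIn-punchOut {k} {suc w} w≢k | no w≮k =
  punchIn-≮ λ w<k → w≢k (sym (≤-antisym (≮⇒≥ w≮k) w<k))

punchOut-mono-< : ∀ {k a b} → a < b → a ≢ k → b ≢ k → punchOut k a < punchOut k b
punchOut-mono-< {k} {a} {b} a<b a≢k b≢k with a <? k | b <? k
... | yes _   | yes _   = a<b
... | yes a<k | no  b≮k = ≤-trans a<k (pred-mono-≤ (≮∧≢⇒> b≮k b≢k))
... | no  a≮k | yes b<k = ⊥-elim (a≮k (<-trans a<b b<k))
punchOut-mono-< {k} {zero}  a<b a≢k b≢k | no a≮k | no _ = ⊥-elim (a≢k (sym (n≤0⇒n≡0 (≮⇒≥ a≮k))))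
punchOut-mono-< {k} {suc a} {suc b} (s≤s a<b) a≢k b≢k | no _ | no _ = a<b

punchOut-positive : ∀ {k w} → 1 ≤ k → 1 ≤ w → w ≢ k → 1 ≤ punchOut k w
punchOut-positive {k} {w} 1≤k 1≤w w≢k with w <? k
... | yes _   = 1≤w
... | no  w≮k = ≤-trans 1≤k (pred-mono-≤ (≮∧≢⇒> w≮k w≢k))

punchOut-≤ : ∀ {k w M} → k ≤ suc M → w ≤ suc M → w ≢ k → punchOut k w ≤ M
punchOut-≤ {k} {w} k≤1+M w≤1+M w≢k with w <? k
... | yes w<k = s≤s⁻¹ (≤-trans w<k k≤1+M)
... | no  _   = pred-mono-≤ w≤1+M

complement-positive : ∀ M u → u ≤ M → 1 ≤ suc M ∸ u
complement-positive M u u≤M = m<n⇒0<n∸m (s≤s u≤M)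

complement-≤ : ∀ M u → 1 ≤ u → suc M ∸ u ≤ M
complement-≤ M (suc u) _ = m∸n≤m M u

module ComplementPunch (M k : ℕ) (1≤k : 1 ≤ k) (k≤1+M : k ≤ suc M) where

  φ : ℕ → ℕ
  φ v = punchIn k (suc M ∸ v)

  ψ : ℕ → ℕ
  ψ w = suc M ∸ punchOut k w

  Avoids-k : ℕ → Set
  Avoids-k w = InRange (suc M) w × w ≢ k

  φ-InRange : ∀ {v} → InRange M v → InRange (suc M) (φ v)
  φ-InRange {v} (1≤v , v≤M) =
    ≤-trans (complement-positive M v v≤M) (proj₁ (punchIn-bounds k _)) ,
    ≤-trans (proj₂ (punchIn-bounds k _)) (s≤s (complement-≤ M v 1≤v))

  ψ-InRange : ∀ {w} → Avoids-k w → InRange M (ψ w)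
  ψ-InRange ((1≤w , w≤1+M) , w≢k) =
    complement-positive M _ (punchOut-≤ k≤1+M w≤1+M w≢k) , complement-≤ M _ (punchOut-positive 1≤k 1≤w w≢k)

  ψ∘φ : ∀ {v} → InRange M v → ψ (φ v) ≡ v
  ψ∘φ (_ , v≤M) = trans (cong (suc M ∸_) (punchOut-punchIn k _)) (m∸[m∸n]≡n (≤-trans v≤M (n≤1+n M)))

  φ∘ψ : ∀ {w} → Avoids-k w → φ (ψ w) ≡ w
  φ∘ψ ((_ , w≤1+M) , w≢k) =
    trans (cong (punchIn k) (m∸[m∸n]≡n (≤-trans (punchOut-≤ k≤1+M w≤1+M w≢k) (n≤1+n M))))
          (punchIn-punchOut w≢k)

  φ-antitone : ∀ {a b} → InRange M a → InRange M b → a < b → φ b < φ a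
  φ-antitone _ (_ , b≤M) a<b = punchIn-mono-< k (∸-monoʳ-< a<b (≤-trans b≤M (n≤1+n M)))

  ψ-antitone : ∀ {a b} → Avoids-k a → Avoids-k b → a < b → ψ b < ψ a
  ψ-antitone (_ , a≢k) ((_ , b≤1+M) , b≢k) a<b =
    ∸-monoʳ-< (punchOut-mono-< a<b a≢k b≢k) (≤-trans (punchOut-≤ k≤1+M b≤1+M b≢k) (n≤1+n M))

  φ-complement : ∀ {j} → j < k → j ≤ M → φ (suc M ∸ j) ≡ j
  φ-complement j<k j≤M = trans (cong (punchIn k) (m∸[m∸n]≡n (≤-trans j≤M (n≤1+n M)))) (punchIn-< j<k)

  ψ-below : ∀ {j} → j < k → ψ j ≡ suc M ∸ j
  ψ-below j<k = cong (suc M ∸_) (punchOut-< j<k)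

  All-InRange : ∀ {l} → Enumerates M l → All (InRange M) l
  All-InRange (_ , mem) = All.tabulate (to (mem _))

  All-Avoids-k : ∀ {l} → Enumerates (suc M) (k ∷ l) → All Avoids-k l
  All-Avoids-k (k∉l ∷ _ , mem) =
    All.tabulate λ {w} w∈l → to (mem w) (there w∈l) , λ w≡k → All.lookup k∉l w∈l (sym w≡k)

  Enumerates-extend : ∀ {l} → Enumerates M l → Enumerates (suc M) (k ∷ map φ l)
  Enumerates-extend {l} (unique , mem) =
    Allₚ.map⁺ (All.tabulate λ {v} _ k≡φv → punchIn≢ k _ (sym k≡φv)) ∷
      Unique-map-injectiveOn φ (λ x∈ y∈ φx≡φy → trans (sym (ψ∘φ (inRange x∈)))
                                                  (trans (cong ψ φx≡φy) (ψ∘φ (inRange y∈)))) unique ,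
    λ w → mk⇔ (to′ w) (from′ w)
    where
    inRange : ∀ {v} → v ∈ l → InRange M v
    inRange = to (mem _)
    to′ : ∀ w → w ∈ k ∷ map φ l → InRange (suc M) w
    to′ w (here refl) = 1≤k , k≤1+M
    to′ w (there w∈) with ∈-map⁻ φ w∈
    ... | v , v∈l , refl = φ-InRange (inRange v∈l)
    from′ : ∀ w → InRange (suc M) w → w ∈ k ∷ map φ l
    from′ w w∈range with w ≟ k
    ... | yes refl = here refl
    ... | no  w≢k  = there (subst (_∈ map φ l) (φ∘ψ (w∈range , w≢k))
                               (∈-map⁺ φ (from (mem _) (ψ-InRange (w∈range , w≢k)))))

  Enumerates-restrict : ∀ {l} → Enumerates (suc M) (k ∷ l) → Enumerates M (map ψ l)
  Enumerates-restrict {l} E@(_ ∷ unique , mem) =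
    Unique-map-injectiveOn ψ (λ x∈ y∈ ψx≡ψy → trans (sym (φ∘ψ (avoids x∈)))
                                                (trans (cong φ ψx≡ψy) (φ∘ψ (avoids y∈)))) unique ,
    λ v → mk⇔ (to′ v) (from′ v)
    where
    avoids : ∀ {w} → w ∈ l → Avoids-k w
    avoids = All.lookup (All-Avoids-k E)
    to′ : ∀ v → v ∈ map ψ l → InRange M v
    to′ v v∈ with ∈-map⁻ ψ v∈
    ... | w , w∈l , refl = ψ-InRange (avoids w∈l)
    from′ : ∀ v → InRange M v → v ∈ map ψ l
    from′ v v∈range with from (mem (φ v)) (φ-InRange v∈range)
    ... | here φv≡k = ⊥-elim (punchIn≢ k _ φv≡k)
    ... | there φv∈ = subst (_∈ map ψ l) (ψ∘φ v∈range) (∈-map⁺ ψ φv∈)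

-- Junk unless 1 ≤ k ≤ n.
entringer : ℕ → ℕ → ℕ
entringer zero          _          = 0
entringer (suc zero)    (suc zero) = 1
entringer (suc zero)    _          = 0
entringer (suc (suc n)) k          = sumRange (λ j → entringer (suc n) (suc (suc n) ∸ j)) 1 (pred k)

module EntringerStep (m k : ℕ) (1≤k : 1 ≤ k) (k≤2+m : k ≤ suc (suc m)) where

  open ComplementPunch (suc m) k 1≤k k≤2+m

  extend : Vec ℕ (suc m) → Vec ℕ (suc (suc m))
  extend τ = k ∷ Vec.map φ τ

  second : Vec ℕ (suc (suc m)) → ℕ
  second (_ ∷ y ∷ _) = y

  toList-extend : ∀ τ → toList (extend τ) ≡ k ∷ map φ (toList τ)
  toList-extend τ = cong (k ∷_) (toList-map φ τ)

  second-range : ∀ σ → EntringerPerm (suc (suc m)) k σ → 1 ≤ second σ × second σ < k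
  second-range (x ∷ y ∷ _) ((σ↭ , y<x , _) , x≡k) =
    proj₁ (to (proj₂ (↭-range⇒Enumerates σ↭) y) (there (here refl))) ,
    subst (y <_) (just-injective x≡k) y<x

  extend-bijection : ∀ {c} j → j < k →
    HasCount (EntringerPerm (suc m) (suc (suc m) ∸ j)) c →
    HasCount (λ σ → EntringerPerm (suc (suc m)) k σ × second σ ≡ j) c
  extend-bijection j j<k = HasCount-bijection extend preserves injective surjective
    where
    j≤1+m : j ≤ suc m
    j≤1+m = s≤s⁻¹ (≤-trans j<k k≤2+m)

    preserves : ∀ τ → EntringerPerm (suc m) (suc (suc m) ∸ j) τ →
                EntringerPerm (suc (suc m)) k (extend τ) × second (extend τ) ≡ j
    preserves τ@(a ∷ _) ((τ↭ , down) , a≡) =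
      ((subst (_↭ map suc (upTo (suc (suc m)))) (sym (toList-extend τ))
              (Enumerates⇒↭-range (Enumerates-extend E)) ,
        subst DownAlt (sym (toList-extend τ))
          (subst (_< k) (sym φa≡j) j<k , DownAlt⇒UpAlt-map φ φ-antitone (All-InRange E) down)) ,
       refl) ,
      φa≡j
      where
      E = ↭-range⇒Enumerates τ↭
      φa≡j : φ a ≡ j
      φa≡j = trans (cong φ (just-injective a≡)) (φ-complement j<k j≤1+m)

    injective : ∀ τ τ′ → EntringerPerm (suc m) _ τ → EntringerPerm (suc m) _ τ′ →
                extend τ ≡ extend τ′ → τ ≡ τ′
    injective τ τ′ ((τ↭ , _) , _) ((τ′↭ , _) , _) eq = toList-injective-≡ τ τ′ (begin
      toList τ                    ≡⟨ map-inverseOn φ ψ (All-InRange (↭-range⇒Enumerates τ↭)) ψ∘φ ⟨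
      map ψ (map φ (toList τ))    ≡⟨ cong (map ψ) (∷-injectiveʳ (begin
        k ∷ map φ (toList τ)        ≡⟨ toList-extend τ ⟨
        toList (extend τ)           ≡⟨ cong toList eq ⟩
        toList (extend τ′)          ≡⟨ toList-extend τ′ ⟩
        k ∷ map φ (toList τ′)       ∎)) ⟩
      map ψ (map φ (toList τ′))   ≡⟨ map-inverseOn φ ψ (All-InRange (↭-range⇒Enumerates τ′↭)) ψ∘φ ⟩
      toList τ′                   ∎)
      where open ≡-Reasoning

    surjective : ∀ σ → EntringerPerm (suc (suc m)) k σ × second σ ≡ j →
                 Σ (Vec ℕ (suc m)) λ τ → EntringerPerm (suc m) (suc (suc m) ∸ j) τ × extend τ ≡ σ
    surjective (x ∷ ρ@(y ∷ _)) (((σ↭ , _ , up) , x≡k) , refl) with just-injective x≡k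
    ... | refl =
      Vec.map ψ ρ ,
      ((subst (_↭ map suc (upTo (suc m))) (sym (toList-map ψ ρ))
              (Enumerates⇒↭-range (Enumerates-restrict E)) ,
        subst DownAlt (sym (toList-map ψ ρ)) (UpAlt⇒DownAlt-map ψ ψ-antitone (All-Avoids-k E) up)) ,
       cong just (ψ-below j<k)) ,
      cong (k ∷_) (toList-injective-≡ _ _ (begin
        toList (Vec.map φ (Vec.map ψ ρ))  ≡⟨ toList-map φ (Vec.map ψ ρ) ⟩
        map φ (toList (Vec.map ψ ρ))      ≡⟨ cong (map φ) (toList-map ψ ρ) ⟩
        map φ (map ψ (toList ρ))          ≡⟨ map-inverseOn ψ φ (All-Avoids-k E) φ∘ψ ⟩
        toList ρ                          ∎))
      where
      open ≡-Reasoning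
      E = ↭-range⇒Enumerates σ↭

entringer-count : ∀ M k → 1 ≤ k → k ≤ suc M → HasCount (EntringerPerm (suc M) k) (entringer (suc M) k)
entringer-count zero (suc zero) _ _ =
  HasCount-cong (λ { σ refl → (↭-refl , tt) , refl })
                (λ { (v ∷ Vec.[]) (_ , v≡1) → cong (_∷ Vec.[]) (just-injective v≡1) })
                (HasCount-singleton (1 ∷ Vec.[]))
entringer-count zero (suc (suc k)) _ (s≤s ())
entringer-count (suc m) (suc k) 1≤1+k 1+k≤2+m =
  HasCount-partition second _ 1 k second-range λ j 1≤j j<1+k →
    extend-bijection j j<1+k
      (entringer-count m (suc (suc m) ∸ j)
        (complement-positive (suc m) j (≤-trans (s≤s⁻¹ j<1+k) (s≤s⁻¹ 1+k≤2+m)))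
        (complement-≤ (suc m) j 1≤j))
  where open EntringerStep m (suc k) 1≤1+k 1+k≤2+m

alternating-count : ∀ M → HasCount (AlternatingPerm (suc M)) (entringer (suc (suc M)) (suc (suc M)))
alternating-count M = HasCount-partition complementOfHead _ 1 (suc M) range parts
  where
  complementOfHead : Vec ℕ (suc M) → ℕ
  complementOfHead σ = suc (suc M) ∸ Vec.head σ

  head-InRange : ∀ σ → AlternatingPerm (suc M) σ → InRange (suc M) (Vec.head σ)
  head-InRange (x ∷ _) (σ↭ , _) = to (proj₂ (↭-range⇒Enumerates σ↭) x) (here refl)

  range : ∀ σ → AlternatingPerm (suc M) σ → 1 ≤ complementOfHead σ × complementOfHead σ < 1 + suc M
  range σ alt = let 1≤x , x≤1+M = head-InRange σ alt in
    complement-positive (suc M) _ x≤1+M , s≤s (complement-≤ (suc M) _ 1≤x)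

  parts : ∀ j → 1 ≤ j → j < 1 + suc M →
          HasCount (λ σ → AlternatingPerm (suc M) σ × complementOfHead σ ≡ j)
                   (entringer (suc M) (suc (suc M) ∸ j))
  parts j 1≤j j<2+M =
    HasCount-cong starts⇒ ⇒starts
      (entringer-count M (suc (suc M) ∸ j) (complement-positive (suc M) j (s≤s⁻¹ j<2+M))
                                           (complement-≤ (suc M) j 1≤j))
    where
    starts⇒ : ∀ σ → EntringerPerm (suc M) (suc (suc M) ∸ j) σ →
              AlternatingPerm (suc M) σ × complementOfHead σ ≡ j
    starts⇒ (x ∷ _) (alt , x≡) =
      alt , trans (cong (suc (suc M) ∸_) (just-injective x≡))
                  (m∸[m∸n]≡n (≤-trans (s≤s⁻¹ j<2+M) (n≤1+n (suc M))))
    ⇒starts : ∀ σ → AlternatingPerm (suc M) σ × complementOfHead σ ≡ j →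
              EntringerPerm (suc M) (suc (suc M) ∸ j) σ
    ⇒starts σ@(x ∷ _) (alt , refl) =
      alt , cong just (sym (m∸[m∸n]≡n (≤-trans (proj₂ (head-InRange σ alt)) (n≤1+n (suc M)))))

at : List ℕ → ℕ → ℕ
at []      _       = 0
at (w ∷ _) zero    = w
at (_ ∷ W) (suc t) = at W t

-- h_t + h_{t−1}, reading entries outside h as 0: the horizontal part of a degree in column t.
pairSum : List ℕ → ℕ → ℕ
pairSum h t = at h t + at (0 ∷ h) t

at-applyUpTo : ∀ (f : ℕ → ℕ) {n t} → t < n → at (applyUpTo f n) t ≡ f t
at-applyUpTo f {suc n} {zero}  _         = refl
at-applyUpTo f {suc n} {suc t} (s≤s t<n) = at-applyUpTo (λ i → f (suc i)) t<n

at-≥-length : ∀ W {t} → length W ≤ t → at W t ≡ 0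
at-≥-length []      _          = refl
at-≥-length (w ∷ W) (s≤s |W|≤t) = at-≥-length W |W|≤t

at-injective : ∀ (B C : List ℕ) → length B ≡ length C → (∀ t → t < length B → at B t ≡ at C t) → B ≡ C
at-injective []      []      _   _     = refl
at-injective (b ∷ B) (c ∷ C) |B| B≐C =
  cong₂ _∷_ (B≐C zero (s≤s z≤n)) (at-injective B C (suc-injective |B|) (λ t t< → B≐C (suc t) (s≤s t<)))

lastOr : ℕ → List ℕ → ℕ
lastOr p []      = p
lastOr p (a ∷ h) = lastOr a h

at-length : ∀ p h → at (p ∷ h) (length h) ≡ lastOr p h
at-length p []      = refl
at-length p (a ∷ h) = at-length a h

pairSum-injective : ∀ (B C : List ℕ) n →
  (∀ t → t ≤ n → pairSum B t ≡ pairSum C t) → ∀ t → t ≤ n → at B t ≡ at C t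
pairSum-injective B C n sums≡ zero    _   = +-cancelʳ-≡ 0 _ _ (sums≡ zero z≤n)
pairSum-injective B C n sums≡ (suc t) t<n =
  +-cancelʳ-≡ (at B t) _ _ (trans (sums≡ (suc t) t<n)
    (cong (at C (suc t) +_) (sym (pairSum-injective B C n sums≡ t (<⇒≤ t<n)))))

padTo : ∀ n → List ℕ → Vec ℕ n
padTo zero    _       = Vec.[]
padTo (suc n) []      = 0 Vec.∷ padTo n []
padTo (suc n) (w ∷ W) = w Vec.∷ padTo n W

toList-padTo : ∀ {n} W → length W ≡ n → toList (padTo n W) ≡ W
toList-padTo []      refl = refl
toList-padTo (w ∷ W) refl = cong (w ∷_) (toList-padTo W refl)

splitAt-length : ∀ (W : List A) a b → length W ≡ a + b →
  Σ (List A) λ xs → Σ (List A) λ ys → W ≡ xs ++ ys × length xs ≡ a × length ys ≡ b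
splitAt-length W       zero    b |W| = [] , W , refl , refl , |W|
splitAt-length (w ∷ W) (suc a) b |W| with splitAt-length W a b (suc-injective |W|)
... | xs , ys , W≡ , |xs| , |ys| = w ∷ xs , ys , cong (w ∷_) W≡ , cong suc |xs| , |ys|

++-injective : ∀ (xs ys : List A) {zs ws} → length xs ≡ length ys → xs ++ zs ≡ ys ++ ws → xs ≡ ys × zs ≡ ws
++-injective []       []       _     eq = refl , eq
++-injective (x ∷ xs) (y ∷ ys) |xs| eq with ∷-injective eq
... | x≡y , eq′ with ++-injective xs ys (suc-injective |xs|) eq′
...   | xs≡ys , zs≡ws = cong₂ _∷_ x≡y xs≡ys , zs≡ws

-- Degrees in the straight snake graph

sumWhere : (ℕ → Bool) → List ℕ → ℕ
sumWhere p []      = 0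
sumWhere p (w ∷ W) = (if p 0 then w else 0) + sumWhere (λ i → p (suc i)) W

sumWhere-false : ∀ W → sumWhere (λ _ → false) W ≡ 0
sumWhere-false []      = refl
sumWhere-false (_ ∷ W) = sumWhere-false W

sumWhere-≡ᵇ : ∀ t W → sumWhere (t ≡ᵇ_) W ≡ at W t
sumWhere-≡ᵇ _       []      = refl
sumWhere-≡ᵇ zero    (w ∷ W) = trans (cong (w +_) (sumWhere-false W)) (+-identityʳ w)
sumWhere-≡ᵇ (suc t) (w ∷ W) = sumWhere-≡ᵇ t W

adjacent : ℕ → ℕ → Bool
adjacent t i = (t ≡ᵇ i) ∨ (t ≡ᵇ suc i)

sumWhere-adjacent : ∀ t W → sumWhere (adjacent t) W ≡ pairSum W t
sumWhere-adjacent zero          []      = refl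
sumWhere-adjacent (suc _)       []      = refl
sumWhere-adjacent zero          (w ∷ W) = cong (w +_) (sumWhere-false W)
sumWhere-adjacent (suc zero)    (w ∷ W) =
  trans (cong (w +_) (sumWhere-adjacent zero W)) (trans (cong (w +_) (+-identityʳ (at W 0))) (+-comm w (at W 0)))
sumWhere-adjacent (suc (suc t)) (w ∷ W) = sumWhere-adjacent (suc t) W

select : {E : Set} → (E → Bool) → E → ℕ → ℕ
select test e m = if test e then m else 0

sum-zipWith-++ : ∀ {E : Set} (f : E → ℕ → ℕ) (es es′ : List E) (ws ws′ : List ℕ) →
  length es ≡ length ws →
  sum (zipWith f (es ++ es′) (ws ++ ws′)) ≡ sum (zipWith f es ws) + sum (zipWith f es′ ws′)
sum-zipWith-++ f []       es′ []       ws′ _  = refl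
sum-zipWith-++ f (e ∷ es) es′ (w ∷ ws) ws′ eq =
  trans (cong (f e w +_) (sum-zipWith-++ f es es′ ws ws′ (cong pred eq))) (sym (+-assoc (f e w) _ _))

sum-select-tabulate : ∀ {E : Set} {n} (e : Fin n → E) (test : E → Bool) (p : ℕ → Bool) →
  (∀ i → test (e i) ≡ p (toℕ i)) → ∀ W → length W ≡ n →
  sum (zipWith (select test) (tabulate e) W) ≡ sumWhere p W
sum-select-tabulate {n = zero}  e test p test≡p []      _  = refl
sum-select-tabulate {n = suc n} e test p test≡p (w ∷ W) eq =
  cong₂ _+_ (cong (λ b → if b then w else 0) (test≡p Fin.zero))
            (sum-select-tabulate (e ∘ Fin.suc) test (p ∘ suc) (test≡p ∘ Fin.suc) W (cong pred eq))

sum-select-allFin : ∀ {E : Set} {n} (e : Fin n → E) (test : E → Bool) (p : ℕ → Bool) →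
  (∀ i → test (e i) ≡ p (toℕ i)) → ∀ W → length W ≡ n →
  sum (zipWith (select test) (map e (allFin n)) W) ≡ sumWhere p W
sum-select-allFin e test p test≡p W eq =
  trans (cong (λ es → sum (zipWith (select test) es W)) (map-tabulate (λ i → i) e))
        (sum-select-tabulate e test p test≡p W eq)

length-map-allFin : ∀ {E : Set} n (e : Fin n → E) → length (map e (allFin n)) ≡ n
length-map-allFin n e = trans (length-map e (allFin n)) (length-tabulate (λ i → i))

isYes-Fin-≟ : ∀ {n} (k i : Fin n) → ⌊ k Fin.≟ i ⌋ ≡ (toℕ k ≡ᵇ toℕ i)
isYes-Fin-≟ Fin.zero    Fin.zero    = refl
isYes-Fin-≟ Fin.zero    (Fin.suc i) = refl
isYes-Fin-≟ (Fin.suc k) Fin.zero    = refl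
isYes-Fin-≟ (Fin.suc k) (Fin.suc i) with k Fin.≟ i | isYes-Fin-≟ k i
... | yes _ | k≡ᵇi = k≡ᵇi
... | no  _ | k≡ᵇi = k≡ᵇi

isYes-≡-dec : {A B : Set} (_≟A_ : DecidableEquality A) (_≟B_ : DecidableEquality B) (a b : A) (x y : B) →
  ⌊ ≡-dec _≟A_ _≟B_ (a , x) (b , y) ⌋ ≡ ⌊ a ≟A b ⌋ ∧ ⌊ x ≟B y ⌋
isYes-≡-dec _≟A_ _≟B_ a b x y with a ≟A b
... | no  _    = refl
... | yes refl with x ≟B y
...   | yes _ = refl
...   | no  _ = refl

module _ (N : ℕ) where

  verticalEdge : Fin (suc N) → SnakeV N × SnakeV N
  verticalEdge k = v₁ k , v₂ k

  bottomEdge topEdge : Fin N → SnakeV N × SnakeV N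
  bottomEdge k = v₁ (inject₁ k) , v₁ (Fin.suc k)
  topEdge    k = v₂ (inject₁ k) , v₂ (Fin.suc k)

  length-edges : length (edges (Snake N)) ≡ suc N + (N + N)
  length-edges = trans (length-++ Es) (cong₂ _+_ (length-map-allFin (suc N) verticalEdge)
                   (trans (length-++ Bs) (cong₂ _+_ (length-map-allFin N bottomEdge) (length-map-allFin N topEdge))))
    where
    Es = map verticalEdge (allFin (suc N))
    Bs = map bottomEdge (allFin N)

  -- ω lists the vertical multiplicities, then the bottom row, then the top row, as snakeEdges does.
  record Blocks (ω : EdgeFun (Snake N)) (A B C : List ℕ) : Set where
    constructor mkBlocks
    field
      toList≡ : toList ω ≡ A ++ B ++ C
      |A|     : length A ≡ suc N
      |B|     : length B ≡ N
      |C|     : length C ≡ N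

  sum-select-edges : ∀ {ω A B C} → Blocks ω A B C →
    (test : SnakeV N × SnakeV N → Bool) (pV pB pT : ℕ → Bool) →
    (∀ i → test (verticalEdge i) ≡ pV (toℕ i)) →
    (∀ i → test (bottomEdge i) ≡ pB (toℕ i)) →
    (∀ i → test (topEdge i) ≡ pT (toℕ i)) →
    sum (zipWith (select test) (edges (Snake N)) (toList ω)) ≡ sumWhere pV A + (sumWhere pB B + sumWhere pT C)
  sum-select-edges {ω} {A} {B} {C} (mkBlocks ω≡ |A| |B| |C|) test pV pB pT testV testB testT = begin
    sum (zipWith f (Es ++ Bs ++ Ts) (toList ω))
      ≡⟨ cong (sum ∘ zipWith f (Es ++ Bs ++ Ts)) ω≡ ⟩
    sum (zipWith f (Es ++ Bs ++ Ts) (A ++ B ++ C))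
      ≡⟨ sum-zipWith-++ f Es (Bs ++ Ts) A (B ++ C) (trans (length-map-allFin (suc N) verticalEdge) (sym |A|)) ⟩
    sum (zipWith f Es A) + sum (zipWith f (Bs ++ Ts) (B ++ C))
      ≡⟨ cong (sum (zipWith f Es A) +_)
              (sum-zipWith-++ f Bs Ts B C (trans (length-map-allFin N bottomEdge) (sym |B|))) ⟩
    sum (zipWith f Es A) + (sum (zipWith f Bs B) + sum (zipWith f Ts C))
      ≡⟨ cong₂ _+_ (sum-select-allFin verticalEdge test pV testV A |A|)
                   (cong₂ _+_ (sum-select-allFin bottomEdge test pB testB B |B|)
                              (sum-select-allFin topEdge test pT testT C |C|)) ⟩
    sumWhere pV A + (sumWhere pB B + sumWhere pT C) ∎
    where
    open ≡-Reasoning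
    f = select test
    Es = map verticalEdge (allFin (suc N))
    Bs = map bottomEdge (allFin N)
    Ts = map topEdge (allFin N)

  isYes-≟V : ∀ (u w : SnakeV N) →
    ⌊ _≟V_ (Snake N) u w ⌋ ≡ (toℕ (proj₁ u) ≡ᵇ toℕ (proj₁ w)) ∧ (toℕ (proj₂ u) ≡ᵇ toℕ (proj₂ w))
  isYes-≟V (r , k) (r′ , i) =
    trans (isYes-≡-dec Fin._≟_ Fin._≟_ r r′ k i) (cong₂ _∧_ (isYes-Fin-≟ r r′) (isYes-Fin-≟ k i))

  incident-ℕ : ∀ v a b → incident (Snake N) v (a , b) ≡
    ((toℕ (proj₁ v) ≡ᵇ toℕ (proj₁ a)) ∧ (toℕ (proj₂ v) ≡ᵇ toℕ (proj₂ a))) ∨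
    ((toℕ (proj₁ v) ≡ᵇ toℕ (proj₁ b)) ∧ (toℕ (proj₂ v) ≡ᵇ toℕ (proj₂ b)))
  incident-ℕ v a b = cong₂ _∨_ (isYes-≟V v a) (isYes-≟V v b)

  incident-horizontal : ∀ (r : Fin 2) (k : Fin (suc N)) i →
    incident (Snake N) (r , k) ((r , inject₁ i) , (r , Fin.suc i)) ≡ adjacent (toℕ k) (toℕ i)
  incident-horizontal r@Fin.zero           k i =
    trans (incident-ℕ (r , k) (r , inject₁ i) (r , Fin.suc i))
          (cong (λ n → (toℕ k ≡ᵇ n) ∨ (toℕ k ≡ᵇ suc (toℕ i))) (toℕ-inject₁ i))
  incident-horizontal r@(Fin.suc Fin.zero) k i =
    trans (incident-ℕ (r , k) (r , inject₁ i) (r , Fin.suc i))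
          (cong (λ n → (toℕ k ≡ᵇ n) ∨ (toℕ k ≡ᵇ suc (toℕ i))) (toℕ-inject₁ i))

  degree-v₁ : ∀ {ω A B C} → Blocks ω A B C → ∀ k →
    degree (Snake N) ω (v₁ k) ≡ at A (toℕ k) + pairSum B (toℕ k)
  degree-v₁ {ω} {A} {B} {C} blocks k = begin
    degree (Snake N) ω (v₁ k)
      ≡⟨ sum-select-edges blocks (incident (Snake N) (v₁ k)) (toℕ k ≡ᵇ_) (adjacent (toℕ k)) (λ _ → false)
           (λ i → trans (incident-ℕ (v₁ k) (v₁ i) (v₂ i)) (∨-identityʳ _))
           (incident-horizontal Fin.zero k) (λ _ → refl) ⟩
    sumWhere (toℕ k ≡ᵇ_) A + (sumWhere (adjacent (toℕ k)) B + sumWhere (λ _ → false) C)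
      ≡⟨ cong₂ _+_ (sumWhere-≡ᵇ (toℕ k) A) (cong₂ _+_ (sumWhere-adjacent (toℕ k) B) (sumWhere-false C)) ⟩
    at A (toℕ k) + (pairSum B (toℕ k) + 0)
      ≡⟨ cong (at A (toℕ k) +_) (+-identityʳ _) ⟩
    at A (toℕ k) + pairSum B (toℕ k) ∎
    where open ≡-Reasoning

  degree-v₂ : ∀ {ω A B C} → Blocks ω A B C → ∀ k →
    degree (Snake N) ω (v₂ k) ≡ at A (toℕ k) + pairSum C (toℕ k)
  degree-v₂ {ω} {A} {B} {C} blocks k = begin
    degree (Snake N) ω (v₂ k)
      ≡⟨ sum-select-edges blocks (incident (Snake N) (v₂ k)) (toℕ k ≡ᵇ_) (λ _ → false) (adjacent (toℕ k))
           (λ i → incident-ℕ (v₂ k) (v₁ i) (v₂ i))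
           (λ _ → refl) (incident-horizontal (Fin.suc Fin.zero) k) ⟩
    sumWhere (toℕ k ≡ᵇ_) A + (sumWhere (λ _ → false) B + sumWhere (adjacent (toℕ k)) C)
      ≡⟨ cong₂ _+_ (sumWhere-≡ᵇ (toℕ k) A) (cong₂ _+_ (sumWhere-false B) (sumWhere-adjacent (toℕ k) C)) ⟩
    at A (toℕ k) + pairSum C (toℕ k) ∎
    where open ≡-Reasoning

  multAt-rightVertical : ∀ {ω A B C} → Blocks ω A B C → multAt (Snake N) ω (rightVertical N) ≡ at A N
  multAt-rightVertical {ω} {A} {B} {C} blocks = begin
    multAt (Snake N) ω (rightVertical N)
      ≡⟨ sum-select-edges blocks isRight (N ≡ᵇ_) (λ _ → false) (λ _ → false)
           isRight-vertical isRight-bottom (λ _ → refl) ⟩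
    sumWhere (N ≡ᵇ_) A + (sumWhere (λ _ → false) B + sumWhere (λ _ → false) C)
      ≡⟨ cong₂ _+_ (sumWhere-≡ᵇ N A) (cong₂ _+_ (sumWhere-false B) (sumWhere-false C)) ⟩
    at A N + 0
      ≡⟨ +-identityʳ _ ⟩
    at A N ∎
    where
    open ≡-Reasoning
    isRight : SnakeV N × SnakeV N → Bool
    isRight e = ⌊ ≡-dec (_≟V_ (Snake N)) (_≟V_ (Snake N)) (rightVertical N) e ⌋
    isRight-vertical : ∀ i → isRight (verticalEdge i) ≡ (N ≡ᵇ toℕ i)
    isRight-vertical i = begin
      isRight (verticalEdge i)
        ≡⟨ isYes-≡-dec (_≟V_ (Snake N)) (_≟V_ (Snake N)) _ _ _ _ ⟩
      ⌊ _≟V_ (Snake N) (v₁ (fromℕ N)) (v₁ i) ⌋ ∧ ⌊ _≟V_ (Snake N) (v₂ (fromℕ N)) (v₂ i) ⌋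
        ≡⟨ cong₂ _∧_ (isYes-≟V (v₁ (fromℕ N)) (v₁ i)) (isYes-≟V (v₂ (fromℕ N)) (v₂ i)) ⟩
      (toℕ (fromℕ N) ≡ᵇ toℕ i) ∧ (toℕ (fromℕ N) ≡ᵇ toℕ i)
        ≡⟨ ∧-idem _ ⟩
      toℕ (fromℕ N) ≡ᵇ toℕ i
        ≡⟨ cong (_≡ᵇ toℕ i) (toℕ-fromℕ N) ⟩
      N ≡ᵇ toℕ i ∎
    isRight-bottom : ∀ i → isRight (bottomEdge i) ≡ false
    isRight-bottom i = trans (isYes-≡-dec (_≟V_ (Snake N)) (_≟V_ (Snake N)) _ _ _ _) (∧-zeroʳ _)

-- Mixed dimer covers as horizontal profiles

module Covers (N : ℕ) (x : Vec ℕ (suc N)) (X : ℕ → ℕ) (lookup-x : ∀ k → lookup x k ≡ X (toℕ k)) where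

  Fits : List ℕ → Set
  Fits h = length h ≡ N × (∀ t → t ≤ N → pairSum h t ≤ X t)

  verticals : List ℕ → List ℕ
  verticals h = applyUpTo (λ t → X t ∸ pairSum h t) (suc N)

  -- padTo only makes toCover total; it is only used on lists of length N.
  toCover : List ℕ → EdgeFun (Snake N)
  toCover h = padTo _ (verticals h ++ h ++ h)

  length-verticals : ∀ h → length (verticals h) ≡ suc N
  length-verticals h = length-applyUpTo (λ t → X t ∸ pairSum h t) (suc N)

  toCover-blocks : ∀ h → length h ≡ N → Blocks N (toCover h) (verticals h) h h
  toCover-blocks h |h| =
    mkBlocks (toList-padTo _ (trans (length-++ (verticals h))
                     (trans (cong₂ _+_ (length-verticals h) (trans (length-++ h) (cong₂ _+_ |h| |h|)))
                            (sym (length-edges N)))))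
             (length-verticals h) |h| |h|

  at-verticals : ∀ h {t} → t ≤ N → at (verticals h) t ≡ X t ∸ pairSum h t
  at-verticals h t≤N = at-applyUpTo (λ t → X t ∸ pairSum h t) (s≤s t≤N)

  toCover-isCover : ∀ {h} → Fits h → CoverOf N x (toCover h)
  toCover-isCover {h} (|h| , fits) (r , k) = trans (degree-at r) (sym (lookup-x k))
    where
    column : at (verticals h) (toℕ k) + pairSum h (toℕ k) ≡ X (toℕ k)
    column = trans (cong (_+ pairSum h (toℕ k)) (at-verticals h (s≤s⁻¹ (toℕ<n k))))
                   (m∸n+n≡m (fits (toℕ k) (s≤s⁻¹ (toℕ<n k))))
    degree-at : ∀ r → degree (Snake N) (toCover h) (r , k) ≡ X (toℕ k)
    degree-at Fin.zero           = trans (degree-v₁ N (toCover-blocks h |h|) k) column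
    degree-at (Fin.suc Fin.zero) = trans (degree-v₂ N (toCover-blocks h |h|) k) column

  toCover-injective : ∀ {h h′} → Fits h → Fits h′ → toCover h ≡ toCover h′ → h ≡ h′
  toCover-injective {h} {h′} (|h| , _) (|h′| , _) eq =
    proj₁ (++-injective h h′ (trans |h| (sym |h′|)) hh≡h′h′)
    where
    lists≡ : verticals h ++ h ++ h ≡ verticals h′ ++ h′ ++ h′
    lists≡ = trans (sym (Blocks.toList≡ (toCover-blocks h |h|)))
                   (trans (cong toList eq) (Blocks.toList≡ (toCover-blocks h′ |h′|)))
    hh≡h′h′ : h ++ h ≡ h′ ++ h′
    hh≡h′h′ = proj₂ (++-injective (verticals h) (verticals h′)
                       (trans (length-verticals h) (sym (length-verticals h′))) lists≡)

  isCover⇒toCover : ∀ {ω} → CoverOf N x ω → Σ (List ℕ) λ h → Fits h × toCover h ≡ ω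
  isCover⇒toCover {ω} cover
    with splitAt-length (toList ω) (suc N) (N + N) (trans (length-toList ω) (length-edges N))
  ... | A , BC , ω≡ , |A| , |BC| with splitAt-length BC N N |BC|
  ... | B , C , BC≡ , |B| , |C| = B , (|B| , B-fits) , toCover-B≡ω
    where
    blocks : Blocks N ω A B C
    blocks = mkBlocks (trans ω≡ (cong (A ++_) BC≡)) |A| |B| |C|

    column : ∀ {t} → t ≤ N → Fin (suc N)
    column t≤N = fromℕ< (s≤s t≤N)

    degree-bottom : ∀ t → t ≤ N → at A t + pairSum B t ≡ X t
    degree-bottom t t≤N = subst (λ s → at A s + pairSum B s ≡ X s) (toℕ-fromℕ< (s≤s t≤N))
      (trans (sym (degree-v₁ N blocks (column t≤N)))
             (trans (cover (v₁ (column t≤N))) (lookup-x (column t≤N))))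

    degree-top : ∀ t → t ≤ N → at A t + pairSum C t ≡ X t
    degree-top t t≤N = subst (λ s → at A s + pairSum C s ≡ X s) (toℕ-fromℕ< (s≤s t≤N))
      (trans (sym (degree-v₂ N blocks (column t≤N)))
             (trans (cover (v₂ (column t≤N))) (lookup-x (column t≤N))))

    B≡C : B ≡ C
    B≡C = at-injective B C (trans |B| (sym |C|)) λ t t<|B| →
      pairSum-injective B C N
        (λ t t≤N → +-cancelˡ-≡ (at A t) _ _ (trans (degree-bottom t t≤N) (sym (degree-top t t≤N))))
                         t (<⇒≤ (subst (t <_) |B| t<|B|))

    B-fits : ∀ t → t ≤ N → pairSum B t ≤ X t
    B-fits t t≤N = subst (pairSum B t ≤_) (degree-bottom t t≤N) (m≤n+m (pairSum B t) (at A t))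

    verticals≡A : verticals B ≡ A
    verticals≡A = at-injective (verticals B) A (trans (length-verticals B) (sym |A|)) λ t t<1+N →
      let t≤N = s≤s⁻¹ (subst (t <_) (length-verticals B) t<1+N) in
      trans (at-verticals B t≤N)
            (trans (cong (_∸ pairSum B t) (sym (degree-bottom t t≤N))) (m+n∸n≡m (at A t) (pairSum B t)))

    toCover-B≡ω : toCover B ≡ ω
    toCover-B≡ω = toList-injective-≡ (toCover B) ω (begin
      toList (toCover B)         ≡⟨ Blocks.toList≡ (toCover-blocks B |B|) ⟩
      verticals B ++ B ++ B      ≡⟨ cong₂ _++_ verticals≡A (cong (B ++_) B≡C) ⟩
      A ++ B ++ C                ≡⟨ Blocks.toList≡ blocks ⟨
      toList ω                   ∎)
      where open ≡-Reasoning

  multAt-toCover : ∀ {h} → Fits h → multAt (Snake N) (toCover h) (rightVertical N) ≡ X N ∸ lastOr 0 h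
  multAt-toCover {h} (|h| , _) = begin
    multAt (Snake N) (toCover h) (rightVertical N)  ≡⟨ multAt-rightVertical N (toCover-blocks h |h|) ⟩
    at (verticals h) N                              ≡⟨ at-verticals h ≤-refl ⟩
    X N ∸ pairSum h N                               ≡⟨ cong (λ n → X N ∸ pairSum h n) (sym |h|) ⟩
    X N ∸ (at h (length h) + at (0 ∷ h) (length h))
      ≡⟨ cong₂ (λ a b → X N ∸ (a + b)) (at-≥-length h ≤-refl) (at-length 0 h) ⟩
    X N ∸ lastOr 0 h                                ∎
    where open ≡-Reasoning

  HasCount-covers : ∀ {m} (R : EdgeFun (Snake N) → Set) →
    HasCount (λ h → Fits h × R (toCover h)) m → HasCount (λ ω → CoverOf N x ω × R ω) m
  HasCount-covers R = HasCount-bijection toCover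
    (λ h (fits , r) → toCover-isCover fits , r)
    (λ h h′ (fits , _) (fits′ , _) → toCover-injective fits fits′)
    (λ ω (cover , r) → let h , fits , h↦ω = isCover⇒toCover cover in
                       h , (fits , subst R (sym h↦ω) r) , h↦ω)

-- The bounds pairSum h t ≤ X t, unfolded from the left (p is the entry before h) so that they
-- extend along _∷ʳ_.
Admissible : (ℕ → ℕ) → ℕ → List ℕ → Set
Admissible X p []      = ⊤
Admissible X p (a ∷ h) = a + p ≤ X 0 × Admissible (X ∘ suc) a h

pairSums⇔Admissible : ∀ X p h →
  (∀ t → t ≤ length h → at h t + at (p ∷ h) t ≤ X t) ⇔ (Admissible X p h × lastOr p h ≤ X (length h))
pairSums⇔Admissible X p []      = mk⇔ (λ bounded → tt , bounded 0 z≤n) (λ { (_ , p≤X₀) zero _ → p≤X₀ })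
pairSums⇔Admissible X p (a ∷ h) = mk⇔
  (λ bounded → let adm , last≤ = to IH (λ t t≤ → bounded (suc t) (s≤s t≤)) in
                (bounded 0 z≤n , adm) , last≤)
  (λ { ((a+p≤ , adm) , last≤) zero _ → a+p≤
     ; ((a+p≤ , adm) , last≤) (suc t) (s≤s t≤) → from IH (adm , last≤) t t≤ })
  where IH = pairSums⇔Admissible (X ∘ suc) a h

Admissible-cong : ∀ {X Y} p h → (∀ i → i < length h → X i ≡ Y i) → Admissible X p h → Admissible Y p h
Admissible-cong p []      X≐Y _            = tt
Admissible-cong p (a ∷ h) X≐Y (a+p≤ , adm) =
  subst (a + p ≤_) (X≐Y 0 (s≤s z≤n)) a+p≤ , Admissible-cong a h (λ i i< → X≐Y (suc i) (s≤s i<)) adm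

Admissible-∷ʳ : ∀ X p h a → Admissible X p (h ∷ʳ a) ⇔ (Admissible X p h × a + lastOr p h ≤ X (length h))
Admissible-∷ʳ X p []      a = mk⇔ (λ (a+p≤ , _) → tt , a+p≤) (λ (_ , a+p≤) → a+p≤ , tt)
Admissible-∷ʳ X p (b ∷ h) a = mk⇔
  (λ (b+p≤ , adm) → let adm′ , a+≤ = to IH adm in (b+p≤ , adm′) , a+≤)
  (λ ((b+p≤ , adm′) , a+≤) → b+p≤ , from IH (adm′ , a+≤))
  where IH = Admissible-∷ʳ (X ∘ suc) b h a

lastOr-∷ʳ : ∀ p h a → lastOr p (h ∷ʳ a) ≡ a
lastOr-∷ʳ p []      a = refl
lastOr-∷ʳ p (b ∷ h) a = lastOr-∷ʳ b h a

secondLastOr : ℕ → List ℕ → ℕ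
secondLastOr p []          = p
secondLastOr p (_ ∷ [])    = p
secondLastOr p (a ∷ b ∷ h) = secondLastOr a (b ∷ h)

secondLastOr-∷ʳ : ∀ p h a → secondLastOr p (h ∷ʳ a) ≡ lastOr p h
secondLastOr-∷ʳ p []          a = refl
secondLastOr-∷ʳ p (b ∷ [])    a = refl
secondLastOr-∷ʳ p (b ∷ c ∷ h) a = secondLastOr-∷ʳ b (c ∷ h) a

length-∷ʳ : ∀ (h : List ℕ) a → length (h ∷ʳ a) ≡ suc (length h)
length-∷ʳ h a = trans (length-++ h) (+-comm (length h) 1)

+≤⇔<∸ : ∀ a b c → b + a ≤ c ⇔ a < suc c ∸ b
+≤⇔<∸ a zero    c       = mk⇔ s≤s s≤s⁻¹
+≤⇔<∸ a (suc b) zero    = mk⇔ (λ ()) (λ a<0∸b → ⊥-elim (n≮0 (subst (a <_) (0∸n≡0 b) a<0∸b)))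
+≤⇔<∸ a (suc b) (suc c) = mk⇔ (to (+≤⇔<∸ a b c) ∘ s≤s⁻¹) (s≤s ∘ from (+≤⇔<∸ a b c))

Profile : ℕ → ℕ → List ℕ → Set
Profile m t h = length h ≡ m × Admissible suc 0 h × lastOr 0 h ≡ t

profile-count : ∀ m t → HasCount (Profile m t) (entringer (2 + m) (2 + m ∸ t))
profile-count zero zero          =
  HasCount-cong (λ { h refl → refl , tt , refl }) (λ { [] _ → refl }) (HasCount-singleton [])
profile-count zero (suc zero)    = HasCount-empty λ { [] (_ , _ , ()) }
profile-count zero (suc (suc t)) rewrite 0∸n≡0 t = HasCount-empty λ { [] (_ , _ , ()) }
profile-count (suc m) t =
  subst (HasCount (Profile (suc m) t)) (cong (sumRange _ 1) (sym (pred[m∸n]≡m∸[1+n] (3 + m) t)))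
    (HasCount-partition (suc ∘ secondLastOr 0) _ 1 (2 + m ∸ t) range parts)
  where
  range : ∀ h → Profile (suc m) t h → 1 ≤ suc (secondLastOr 0 h) × suc (secondLastOr 0 h) < 1 + (2 + m ∸ t)
  range h profile with initLast h
  range .[] (() , _) | []
  range .(h′ ∷ʳ a) (|h| , adm , last≡t) | h′ ∷ʳ′ a =
    s≤s z≤n ,
    s≤s (subst (_< 2 + m ∸ t) (sym (secondLastOr-∷ʳ 0 h′ a))
          (to (+≤⇔<∸ (lastOr 0 h′) t (suc m))
              (subst₂ (λ s n → s + lastOr 0 h′ ≤ suc n) (trans (sym (lastOr-∷ʳ 0 h′ a)) last≡t)
                      (cong pred (trans (sym (length-∷ʳ h′ a)) |h|))
                      (proj₂ (to (Admissible-∷ʳ suc 0 h′ a) adm)))))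
  parts : ∀ j → 1 ≤ j → j < 1 + (2 + m ∸ t) →
          HasCount (λ h → Profile (suc m) t h × suc (secondLastOr 0 h) ≡ j) (entringer (2 + m) (3 + m ∸ j))
  parts (suc j) _ (s≤s j<) =
    HasCount-bijection (_∷ʳ t) preserves (λ h h′ _ _ → ∷ʳ-injectiveˡ h h′) surjective (profile-count m j)
    where
    preserves : ∀ h → Profile m j h → Profile (suc m) t (h ∷ʳ t) × suc (secondLastOr 0 (h ∷ʳ t)) ≡ suc j
    preserves h (|h| , adm , last≡j) =
      (trans (length-∷ʳ h t) (cong suc |h|) ,
       from (Admissible-∷ʳ suc 0 h t)
         (adm , subst₂ (λ s n → t + s ≤ suc n) (sym last≡j) (sym |h|) (from (+≤⇔<∸ j t (suc m)) j<)) ,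
       lastOr-∷ʳ 0 h t) ,
      cong suc (trans (secondLastOr-∷ʳ 0 h t) last≡j)
    surjective : ∀ h → Profile (suc m) t h × suc (secondLastOr 0 h) ≡ suc j →
                 Σ (List ℕ) λ h′ → Profile m j h′ × h′ ∷ʳ t ≡ h
    surjective h profile with initLast h
    surjective .[] ((() , _) , _) | []
    surjective .(h′ ∷ʳ a) ((|h| , adm , last≡t) , key≡) | h′ ∷ʳ′ a =
      h′ ,
      (cong pred (trans (sym (length-∷ʳ h′ a)) |h|) ,
       proj₁ (to (Admissible-∷ʳ suc 0 h′ a) adm) ,
       trans (sym (secondLastOr-∷ʳ 0 h′ a)) (cong pred key≡)) ,
      cong (h′ ∷ʳ_) (trans (sym last≡t) (lastOr-∷ʳ 0 h′ a))

module _ (N : ℕ) (x : Vec ℕ (suc N)) (X : ℕ → ℕ) (lookup-x : ∀ k → lookup x k ≡ X (toℕ k))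
         (X-standard : ∀ i → i < N → X i ≡ suc i) where

  open Covers N x X lookup-x

  Fits⇔Admissible : ∀ h → Fits h ⇔ (length h ≡ N × Admissible suc 0 h × lastOr 0 h ≤ X N)
  Fits⇔Admissible h = mk⇔
    (λ (|h| , bounded) →
      let adm , last≤ = to (pairSums⇔Admissible X 0 h) (λ t t≤ → bounded t (subst (t ≤_) |h| t≤)) in
      |h| , Admissible-cong 0 h (λ i i< → X-standard i (subst (i <_) |h| i<)) adm ,
      subst (λ n → lastOr 0 h ≤ X n) |h| last≤)
    (λ (|h| , adm , last≤) →
      |h| , λ t t≤N → from (pairSums⇔Admissible X 0 h)
                        (Admissible-cong 0 h (λ i i< → sym (X-standard i (subst (i <_) |h| i<))) adm ,
                         subst (λ n → lastOr 0 h ≤ X n) (sym |h|) last≤)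
                        t (subst (t ≤_) (sym |h|) t≤N))

  Profile⇒Fits : ∀ {t h} → t ≤ X N → Profile N t h → Fits h
  Profile⇒Fits t≤ (|h| , adm , last≡t) = from (Fits⇔Admissible _) (|h| , adm , subst (_≤ X N) (sym last≡t) t≤)

  fits-count : HasCount Fits (entringer (3 + N) (2 + X N))
  fits-count = HasCount-partition (suc ∘ lastOr 0) _ 1 (suc (X N)) range parts
    where
    range : ∀ h → Fits h → 1 ≤ suc (lastOr 0 h) × suc (lastOr 0 h) < 1 + suc (X N)
    range h fits = s≤s z≤n , s≤s (s≤s (proj₂ (proj₂ (to (Fits⇔Admissible h) fits))))
    parts : ∀ j → 1 ≤ j → j < 1 + suc (X N) →
            HasCount (λ h → Fits h × suc (lastOr 0 h) ≡ j) (entringer (2 + N) (3 + N ∸ j))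
    parts (suc t) _ (s≤s (s≤s t≤)) = HasCount-cong
      (λ h profile → Profile⇒Fits t≤ profile , cong suc (proj₂ (proj₂ profile)))
      (λ h (fits , last≡) → let |h| , adm , _ = to (Fits⇔Admissible h) fits in |h| , adm , cong pred last≡)
      (profile-count N t)

  covers-count : HasCount (CoverOf N x) (entringer (3 + N) (2 + X N))
  covers-count =
    HasCount-cong (λ ω (cover , _) → cover) (λ ω cover → cover , tt)
      (HasCount-covers (λ _ → ⊤) (HasCount-cong (λ h fits → fits , tt) (λ h (fits , _) → fits) fits-count))

  covers-count-rightVertical : ∀ t → t ≤ X N →
    HasCount (λ ω → CoverOf N x ω × multAt (Snake N) ω (rightVertical N) ≡ X N ∸ t)
             (entringer (2 + N) (2 + N ∸ t))
  covers-count-rightVertical t t≤ = HasCount-covers (λ ω → multAt (Snake N) ω (rightVertical N) ≡ X N ∸ t)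
    (HasCount-cong
      (λ h profile → let fits = Profile⇒Fits t≤ profile in
                     fits , trans (multAt-toCover fits) (cong (X N ∸_) (proj₂ (proj₂ profile))))
      (λ h (fits , mult≡) → let |h| , adm , last≤ = to (Fits⇔Admissible h) fits in
                            |h| , adm , ∸-cancelˡ-≡ last≤ t≤ (trans (sym (multAt-toCover fits)) mult≡))
      (profile-count N t))

lookup-standardX : ∀ N k → lookup (standardX N) k ≡ suc (toℕ k)
lookup-standardX N = lookup∘tabulate (suc ∘ toℕ)

modifiedLabel : ℕ → ℕ → ℕ → ℕ
modifiedLabel N c t = if t <ᵇ N then suc t else c

lookup-tabulate-∷ʳ : ∀ {N} (f : ℕ → ℕ) c (k : Fin (suc N)) →
  lookup (Vec.tabulate (f ∘ toℕ) Vec.∷ʳ c) k ≡ (if toℕ k <ᵇ N then f (toℕ k) else c)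
lookup-tabulate-∷ʳ {zero}  f c Fin.zero    = refl
lookup-tabulate-∷ʳ {suc N} f c Fin.zero    = refl
lookup-tabulate-∷ʳ {suc N} f c (Fin.suc k) = lookup-tabulate-∷ʳ (f ∘ suc) c k

if-<ᵇ : ∀ {t N} {a b : A} → t < N → (if t <ᵇ N then a else b) ≡ a
if-<ᵇ {t = zero}  {suc N} _         = refl
if-<ᵇ {t = suc t} {suc N} (s≤s t<N) = if-<ᵇ t<N

if-<ᵇ-irrefl : ∀ N {a b : A} → (if N <ᵇ N then a else b) ≡ b
if-<ᵇ-irrefl zero    = refl
if-<ᵇ-irrefl (suc N) = if-<ᵇ-irrefl N

standard-covers-count : ∀ N → HasCount (Ω N) (entringer (3 + N) (3 + N))
standard-covers-count N = covers-count N (standardX N) suc (lookup-standardX N) (λ _ _ → refl)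

standard-covers-count-rightVertical : ∀ N t → t ≤ suc N →
  HasCount (λ ω → Ω N ω × multAt (Snake N) ω (rightVertical N) ≡ suc N ∸ t) (entringer (2 + N) (2 + N ∸ t))
standard-covers-count-rightVertical N =
  covers-count-rightVertical N (standardX N) suc (lookup-standardX N) (λ _ _ → refl)

modified-covers-count : ∀ N c → HasCount (CoverOf N (modifiedX N c)) (entringer (3 + N) (2 + c))
modified-covers-count N c =
  subst (λ c′ → HasCount (CoverOf N (modifiedX N c)) (entringer (3 + N) (2 + c′))) (if-<ᵇ-irrefl N)
    (covers-count N (modifiedX N c) (modifiedLabel N c) (lookup-tabulate-∷ʳ suc c) (λ _ → if-<ᵇ))

alternating-count≡covers-count : (n : ℕ) → 2 ≤ n →
  ∃ λ m → HasCount (AlternatingPerm n) m × HasCount (Ω (n ∸ 2)) m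
alternating-count≡covers-count (suc zero)    (s≤s ())
alternating-count≡covers-count (suc (suc N)) _ = _ , alternating-count (suc N) , standard-covers-count N

entringer-count≡covers-count : (n k : ℕ) → 3 ≤ n → 1 ≤ k → k ≤ n →
  ∃ λ m →
    HasCount (EntringerPerm n (n + 1 ∸ k)) m
    × HasCount (λ ω → Ω (n ∸ 2) ω × multAt (Snake (n ∸ 2)) ω (rightVertical (n ∸ 2)) ≡ n ∸ k) m
    × (4 ≤ n → (k ≤ n ∸ 1 → HasCount (CoverOf (n ∸ 3) (modifiedX (n ∸ 3) (n ∸ 1 ∸ k))) m)
               × (k ≡ n → m ≡ 0))
entringer-count≡covers-count (suc zero)       _ (s≤s ())       _ _
entringer-count≡covers-count (suc (suc zero)) _ (s≤s (s≤s ())) _ _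
entringer-count≡covers-count n@(suc (suc (suc N))) (suc k) _ _ (s≤s k≤2+N) =
  entringer n (n ∸ k) ,
  subst (λ s → HasCount (EntringerPerm n s) (entringer n (n ∸ k))) (cong (_∸ suc k) (+-comm 1 n))
    (entringer-count (2 + N) (n ∸ k) (complement-positive (2 + N) k k≤2+N) (m∸n≤m n k)) ,
  standard-covers-count-rightVertical (suc N) k k≤2+N ,
  λ 4≤n → modified 4≤n , λ { refl → cong (entringer n) (m+n∸n≡m 1 N) }
  where
  modified : 4 ≤ n → suc k ≤ n ∸ 1 →
             HasCount (CoverOf (n ∸ 3) (modifiedX (n ∸ 3) (n ∸ 1 ∸ suc k))) (entringer n (n ∸ k))
  modified (s≤s (s≤s (s≤s (s≤s _)))) (s≤s k≤) =
    subst (HasCount _) (cong (entringer n) (sym (+-∸-assoc 2 k≤))) (modified-covers-count (n ∸ 3) (n ∸ 2 ∸ k))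

theorem3 :
    ((n : ℕ) → 2 ≤ n →
       ∃ λ m → HasCount (AlternatingPerm n) m × HasCount (Ω (n ∸ 2)) m)
    ×
    ((n k : ℕ) → 3 ≤ n → 1 ≤ k → k ≤ n →
       ∃ λ m →
         HasCount (EntringerPerm n (n + 1 ∸ k)) m
         × HasCount (λ ω → Ω (n ∸ 2) ω
                         × multAt (Snake (n ∸ 2)) ω (rightVertical (n ∸ 2)) ≡ n ∸ k) m
         × (4 ≤ n →
              (k ≤ n ∸ 1 →
                 HasCount (CoverOf (n ∸ 3) (modifiedX (n ∸ 3) (n ∸ 1 ∸ k))) m)
              × (k ≡ n → m ≡ 0)))
theorem3 = alternating-count≡covers-count , entringer-count≡covers-count
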